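{- Let $K\ge2$, let $\mathcal{X}$ be a finite sorted collection of positive reals, and run the algorithm described in the context. During any stretch of the execution in which $\mathcal{X}_1$ remains a maximum sum set (i.e. $S_1=\max_k S_k$), the elements leave $\mathcal{X}_1$ in nonincreasing order of value.
   Context: Algorithm (input: integer $K\ge2$ and $\mathcal{X}=\{x_1,\ldots,x_N\}$, positive reals with $x_1\le\cdots\le x_N$; $S_k=\sum_{x\in\mathcal{X}_k}x$ denotes current set sums): (1) $\mathcal{X}_1=\mathcal{X}$, $\mathcal{X}_k=\emptyset$ for $k\ge2$, $\mathcal{K}=\{1,\ldots,K\}$. (2) If $|\mathcal{K}|=1$ stop. (3) Let $i\in\mathcal{K}$ index a set of largest sum among those indexed by $\mathcal{K}$. (4) Let $j\in\arg\min_k S_k$. (5) $\mathcal{X}_*=\{x\in\mathcal{X}_i:|(S_i-x)-(S_j+x)|<|S_i-S_j|\}$. (6) If $\mathcal{X}_*=\emptyset$, remove $i$ from $\mathcal{K}$ and go to (2); else $x_*=\max\mathcal{X}_*$. (7) Move $x_*$ from $\mathcal{X}_i$ to $\mathcal{X}_j$, update sums, go to (2). -}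

module Defs where

open import Level using (0ℓ)
open import Data.Nat as ℕ using (ℕ; zero; suc; _+_)
open import Data.Fin as Fin using (Fin; zero; suc)
open import Data.Bool using (Bool; true; false; if_then_else_; _∧_; not)
open import Data.Product using (_×_; ∃)
open import Relation.Nullary using (¬_)
open import Relation.Nullary.Decidable using (⌊_⌋)
open import Relation.Binary.Core using (Rel)
open import Relation.Binary.Definitions using (Tri; tri<; tri≈; tri>)
open import Relation.Binary.Structures using (IsStrictTotalOrder)
open import Relation.Binary.PropositionalEquality using (_≡_)
open import Algebra.Structures using (IsCommutativeRing)
open import Data.Sum using (_⊎_)

-- An ordered field (the reals ℝ are a model).  Agda's library has no
-- real numbers, so the statement is made for an arbitrary ordered field.

record OrderedField : Set₁ where
  infixl 6 _+F_ _-F_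
  infixl 7 _*F_
  infix 4 _<F_
  field
    Carrier  : Set
    _+F_ _*F_ : Carrier → Carrier → Carrier
    -F_      : Carrier → Carrier
    0F 1F    : Carrier
    _<F_     : Rel Carrier 0ℓ
    isCommutativeRing  : IsCommutativeRing _≡_ _+F_ _*F_ -F_ 0F 1F
    isStrictTotalOrder : IsStrictTotalOrder _≡_ _<F_
    0<1      : 0F <F 1F
    +-mono-< : ∀ {a b} c → a <F b → a +F c <F b +F c
    *-pos    : ∀ {a b} → 0F <F a → 0F <F b → 0F <F a *F b
    inverse  : ∀ a → ¬ (a ≡ 0F) → ∃ λ b → a *F b ≡ 1F

  _-F_ : Carrier → Carrier → Carrier
  a -F b = a +F (-F b)

  _≤F_ : Carrier → Carrier → Set
  a ≤F b = a <F b ⊎ a ≡ b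

  absF : Carrier → Carrier
  absF a with IsStrictTotalOrder.compare isStrictTotalOrder a 0F
  ... | tri< _ _ _ = -F a
  ... | tri≈ _ _ _ = a
  ... | tri> _ _ _ = a

sumFin : {C : Set} → (C → C → C) → C → (n : ℕ) → (Fin n → C) → C
sumFin _⊕_ e zero    f = e
sumFin _⊕_ e (suc n) f = f zero ⊕ sumFin _⊕_ e n (λ i → f (suc i))

countTrue : (n : ℕ) → (Fin n → Bool) → ℕ
countTrue n b = sumFin _+_ 0 n (λ i → if b i then 1 else 0)

-- The N input numbers are x : Fin N → Carrier (elements
-- are distinguished by index, so repeated values are allowed).  A state
-- records, for each element, the index of the set X_k containing it, and
-- the current index set 𝒦 (as a Boolean predicate on Fin K).

record State (K N : ℕ) : Set where
  field
    assign : Fin N → Fin K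
    active : Fin K → Bool
open State public

-- the number of sets is K = k + 2 ≥ 2
module Algorithm (F : OrderedField) {k N : ℕ} (x : Fin N → OrderedField.Carrier F) where
  open OrderedField F

  K : ℕ
  K = suc (suc k)

  S : State K N → Fin K → Carrier
  S st k = sumFin _+F_ 0F N (λ n → if ⌊ assign st n Fin.≟ k ⌋ then x n else 0F)

  -- initial state: X_1 = X, all other sets empty, 𝒦 = {1,…,K}
  -- (set X_1 is indexed by Fin.zero)
  Initial : State K N → Set
  Initial st = (∀ n → assign st n ≡ zero) × (∀ k → active st k ≡ true)

  -- element n belongs to the set X_* of step (5) for the choice (i, j)
  Candidate : State K N → Fin K → Fin K → Fin N → Set
  Candidate st i j n =
    assign st n ≡ i ×
    absF ((S st i -F x n) -F (S st j +F x n)) <F absF (S st i -F S st j)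

  Choice : State K N → Fin K → Fin K → Set
  Choice st i j =
    2 ℕ.≤ countTrue K (active st) ×
    active st i ≡ true ×
    (∀ k → active st k ≡ true → S st k ≤F S st i) ×
    (∀ k → S st j ≤F S st k)

  -- one iteration of the loop (2)–(7), with all admissible choices of
  -- i, j and of the element realising max X_*
  data Step (st st' : State K N) : Set where
    discard : (i j : Fin K) → Choice st i j →
              (∀ n → ¬ Candidate st i j n) →
              (∀ n → assign st' n ≡ assign st n) →
              (∀ k → active st' k ≡ (active st k ∧ not ⌊ k Fin.≟ i ⌋)) →
              Step st st'
    move    : (i j : Fin K) (m : Fin N) → Choice st i j →
              Candidate st i j m →
              (∀ n → Candidate st i j n → x n ≤F x m) →
              (∀ n → assign st' n ≡ (if ⌊ n Fin.≟ m ⌋ then j else assign st n)) →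
              (∀ k → active st' k ≡ active st k) →
              Step st st'

  Execution : (ℕ → State K N) → ℕ → Set
  Execution s T = Initial (s 0) × (∀ t → t ℕ.< T → Step (s t) (s (suc t)))

  IsMaxSet : State K N → Fin K → Set
  IsMaxSet st k = ∀ k' → S st k' ≤F S st k

  LeavesFirst : (ℕ → State K N) → ℕ → Fin N → Set
  LeavesFirst s t n = assign (s t) n ≡ zero × ¬ (assign (s (suc t)) n ≡ zero)

-- Moving x from a set of sum A to a set of sum B ≤ A reduces |A − B| exactly when B + x < A.
-- While X₁ is a maximum set it is never the receiver (whose sum is below the donor's), so
-- S₁ never grows and X₁ gains no element; and the minimum sum never decreases, since the
-- donor keeps more than B and the receiver only grows.  So if n leaves X₁ for a set of sum B
-- at time t and n′ leaves X₁ for a set of sum B′ at a later time t′, then n′ was already in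
-- X₁ at time t and B + x n′ ≤ B′ + x n′ < S₁(t′) ≤ S₁(t): n′ was a candidate when n was
-- chosen as the largest one.  The input need not be sorted.
module Submission where

open import Defs
open import Level using (0ℓ)
open import Data.Nat using (ℕ; zero; suc; _≤_; _<_; _≤′_; ≤′-reflexive; ≤′-step)
import Data.Nat.Properties as ℕ
open import Data.Fin using (Fin; zero; suc)
import Data.Fin as Fin
open import Data.Fin.Properties using (suc-injective)
open import Data.Bool using (if_then_else_)
open import Data.Empty using (⊥-elim)
open import Data.Product using (_×_; _,_; proj₁; proj₂; map₂)
open import Data.Sum using (inj₁; inj₂)
open import Algebra.Bundles using (CommutativeMonoid; CommutativeRing)
open import Function using (_∘_; _⇔_; mk⇔; Equivalence)
import Function.Properties.Equivalence as ⇔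
open import Relation.Binary.Core using (Rel)
open import Relation.Binary.Bundles using (StrictPartialOrder)
open import Relation.Binary.Definitions using (Reflexive; Transitive; tri<; tri≈; tri>)
open import Relation.Binary.Structures using (IsStrictTotalOrder)
open import Relation.Binary.PropositionalEquality
  using (_≡_; _≢_; refl; sym; trans; cong; subst; subst₂; module ≡-Reasoning)
import Relation.Binary.Reasoning.StrictPartialOrder
open import Relation.Nullary using (¬_)
open import Relation.Nullary.Decidable using (⌊_⌋; yes; no)

module _ {a ℓ} {A : Set a} {R : Rel A ℓ} (R-refl : Reflexive R) (R-trans : Transitive R) where

  compose-steps : (s : ℕ → A) {t t′ : ℕ} → t ≤ t′ →
                  (∀ {u} → t ≤ u → u < t′ → R (s u) (s (suc u))) → R (s t) (s t′)
  compose-steps s t≤t′ = go (ℕ.≤⇒≤′ t≤t′)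
    where
    go : ∀ {t t′} → t ≤′ t′ → (∀ {u} → t ≤ u → u < t′ → R (s u) (s (suc u))) → R (s t) (s t′)
    go (≤′-reflexive refl) _    = R-refl
    go (≤′-step {u} t≤′u) step =
      R-trans (go t≤′u (λ t≤v v<u → step t≤v (ℕ.m<n⇒m<1+n v<u))) (step (ℕ.≤′⇒≤ t≤′u) (ℕ.n<1+n u))

module _ {ℓ} (M : CommutativeMonoid 0ℓ ℓ) where
  open CommutativeMonoid M
    using (Carrier; _≈_; _∙_; ε; ∙-cong; ∙-congˡ; ∙-congʳ; assoc; setoid) renaming (refl to ≈-refl)
  open import Relation.Binary.Reasoning.Setoid setoid
  open import Algebra.Solver.CommutativeMonoid M using (solve; _⊜_; _⊕_)

  sumFin-cong : ∀ n {f g : Fin n → Carrier} → (∀ i → f i ≈ g i) → sumFin _∙_ ε n f ≈ sumFin _∙_ ε n g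
  sumFin-cong zero    f≈g = ≈-refl
  sumFin-cong (suc n) f≈g = ∙-cong (f≈g zero) (sumFin-cong n (λ i → f≈g (suc i)))

  sumFin-update : ∀ n (f g : Fin n → Carrier) m → (∀ i → i ≢ m → g i ≈ f i) →
                  sumFin _∙_ ε n g ∙ f m ≈ sumFin _∙_ ε n f ∙ g m
  sumFin-update (suc n) f g zero g≈f = begin
    (g zero ∙ Σg) ∙ f zero  ≈⟨ ∙-congʳ (∙-congˡ (sumFin-cong n (λ i → g≈f (suc i) λ ())) ) ⟩
    (g zero ∙ Σf) ∙ f zero  ≈⟨ solve 3 (λ a b c → (a ⊕ b) ⊕ c ⊜ (c ⊕ b) ⊕ a) ≈-refl (g zero) Σf (f zero) ⟩
    (f zero ∙ Σf) ∙ g zero  ∎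
    where
    Σf = sumFin _∙_ ε n (λ i → f (suc i))
    Σg = sumFin _∙_ ε n (λ i → g (suc i))
  sumFin-update (suc n) f g (suc m) g≈f = begin
    (g zero ∙ Σg) ∙ f (suc m)   ≈⟨ assoc _ _ _ ⟩
    g zero ∙ (Σg ∙ f (suc m))   ≈⟨ ∙-cong (g≈f zero λ ()) (sumFin-update n (λ i → f (suc i)) (λ i → g (suc i)) m
                                    (λ i i≢m → g≈f (suc i) (λ i≡m → i≢m (suc-injective i≡m)))) ⟩
    f zero ∙ (Σf ∙ g (suc m))   ≈⟨ assoc _ _ _ ⟨
    (f zero ∙ Σf) ∙ g (suc m)   ∎
    where
    Σf = sumFin _∙_ ε n (λ i → f (suc i))
    Σg = sumFin _∙_ ε n (λ i → g (suc i))

module OrderedFieldProperties (F : OrderedField) where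
  open OrderedField F
  open IsStrictTotalOrder isStrictTotalOrder
    using (compare; isStrictPartialOrder; irrefl) renaming (trans to <-trans)

  private
    commutativeRing : CommutativeRing _ _
    commutativeRing = record { isCommutativeRing = isCommutativeRing }

  open CommutativeRing commutativeRing
    using (+-comm; +-identityˡ; +-identityʳ; +-abelianGroup; +-commutativeMonoid) public
  open import Algebra.Solver.CommutativeMonoid +-commutativeMonoid using (solve; _⊜_; _⊕_)
  open import Algebra.Properties.AbelianGroup +-abelianGroup
    using (//-rightDividesˡ; //-rightDividesʳ; ⁻¹-anti-homo‿-; ⁻¹-∙-comm)

  strictPartialOrder : StrictPartialOrder _ _ _
  strictPartialOrder = record { isStrictPartialOrder = isStrictPartialOrder }

  module <-Reasoning = Relation.Binary.Reasoning.StrictPartialOrder strictPartialOrder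

  <-irrefl : ∀ {a} → ¬ (a <F a)
  <-irrefl = irrefl refl

  ≰⇒> : ∀ {a b} → ¬ (a ≤F b) → b <F a
  ≰⇒> {a} {b} a≰b with compare a b
  ... | tri< a<b _ _ = ⊥-elim (a≰b (inj₁ a<b))
  ... | tri≈ _ a≡b _ = ⊥-elim (a≰b (inj₂ a≡b))
  ... | tri> _ _ b<a = b<a

  +-monoˡ-≤ : ∀ {a b} c → a ≤F b → (a +F c) ≤F (b +F c)
  +-monoˡ-≤ c (inj₁ a<b) = inj₁ (+-mono-< c a<b)
  +-monoˡ-≤ c (inj₂ refl) = inj₂ refl

  +-monoʳ-< : ∀ {a b} c → a <F b → c +F a <F c +F b
  +-monoʳ-< {a} {b} c a<b = subst₂ _<F_ (+-comm a c) (+-comm b c) (+-mono-< c a<b)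

  +-monoʳ-≤ : ∀ {a b} c → a ≤F b → (c +F a) ≤F (c +F b)
  +-monoʳ-≤ c (inj₁ a<b) = inj₁ (+-monoʳ-< c a<b)
  +-monoʳ-≤ c (inj₂ refl) = inj₂ refl

  +-cancelʳ-< : ∀ {a b} c → a +F c <F b +F c → a <F b
  +-cancelʳ-< {a} {b} c a+c<b+c =
    subst₂ _<F_ (//-rightDividesʳ c a) (//-rightDividesʳ c b) (+-mono-< (-F c) a+c<b+c)

  a<a+c : ∀ a {c} → 0F <F c → a <F a +F c
  a<a+c a {c} 0<c = subst (_<F a +F c) (+-identityʳ a) (+-monoʳ-< a 0<c)

  a<b+c⇒a-c<b : ∀ {a b c} → a <F b +F c → a -F c <F b
  a<b+c⇒a-c<b {a} {b} {c} a<b+c = +-cancelʳ-< c (subst (_<F b +F c) (sym (//-rightDividesˡ c a)) a<b+c)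

  a+b≤c⇒a≤c-b : ∀ {a b c} → (a +F b) ≤F c → a ≤F (c -F b)
  a+b≤c⇒a≤c-b {a} {b} a+b≤c = subst (_≤F _) (//-rightDividesʳ b a) (+-monoˡ-≤ (-F b) a+b≤c)

  c<a-b⇔b+c<a : ∀ {a b c} → c <F a -F b ⇔ b +F c <F a
  c<a-b⇔b+c<a {a} {b} {c} = mk⇔
    (λ c<a-b → subst₂ _<F_ (+-comm c b) (//-rightDividesˡ b a) (+-mono-< b c<a-b))
    (λ b+c<a → subst (_<F a -F b) (//-rightDividesʳ b c)
                  (+-mono-< (-F b) (subst (_<F a) (+-comm b c) b+c<a)))

  ≤-trans : ∀ {a b c} → a ≤F b → b ≤F c → a ≤F c
  ≤-trans {a} {b} {c} a≤b b≤c = begin a ≤⟨ a≤b ⟩ b ≤⟨ b≤c ⟩ c ∎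
    where open <-Reasoning

  0≤a⇒abs[a]≡a : ∀ {a} → 0F ≤F a → absF a ≡ a
  0≤a⇒abs[a]≡a {a} 0≤a with compare a 0F
  ... | tri< a<0 _ _ = ⊥-elim (<-irrefl (begin-strict a <⟨ a<0 ⟩ 0F ≤⟨ 0≤a ⟩ a ∎))
    where open <-Reasoning
  ... | tri≈ _ _ _ = refl
  ... | tri> _ _ _ = refl

  a<0⇒abs[a]≡-a : ∀ {a} → a <F 0F → absF a ≡ -F a
  a<0⇒abs[a]≡-a {a} a<0 with compare a 0F
  ... | tri< _ _ _ = refl
  ... | tri≈ a≮0 _ _ = ⊥-elim (a≮0 a<0)
  ... | tri> a≮0 _ _ = ⊥-elim (a≮0 a<0)

  abs-elim : ∀ (P : Carrier → Set) {a} → P a → P (-F a) → P (absF a)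
  abs-elim P {a} Pa P-a with compare a 0F
  ... | tri< _ _ _ = P-a
  ... | tri≈ _ _ _ = Pa
  ... | tri> _ _ _ = Pa

  abs[d-2c]<abs[d]⇔c<d : ∀ {c} d → 0F <F c → absF (d -F (c +F c)) <F absF d ⇔ c <F d
  abs[d-2c]<abs[d]⇔c<d {c} d 0<c = mk⇔ to from
    where
    open <-Reasoning
    0<2c : 0F <F c +F c
    0<2c = <-trans 0<c (a<a+c c 0<c)

    from : c <F d → absF (d -F (c +F c)) <F absF d
    from c<d = subst (absF (d -F (c +F c)) <F_) (sym (0≤a⇒abs[a]≡a (inj₁ 0<d)))
      (abs-elim (_<F d) (a<b+c⇒a-c<b (a<a+c d 0<2c))
                        (subst (_<F d) (sym (⁻¹-anti-homo‿- d (c +F c))) (a<b+c⇒a-c<b 2c<d+d)))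
      where
      0<d = <-trans 0<c c<d
      2c<d+d : c +F c <F d +F d
      2c<d+d = begin-strict
        c +F c  <⟨ +-mono-< c c<d ⟩
        d +F c  <⟨ +-monoʳ-< d c<d ⟩
        d +F d  ∎

    abs[d]≤abs[d-2c] : d ≤F c → absF d ≤F absF (d -F (c +F c))
    abs[d]≤abs[d-2c] d≤c = subst (absF d ≤F_) (sym |d-2c|≡2c-d)
      (abs-elim (_≤F ((c +F c) -F d)) d≤2c-d (subst (_≤F ((c +F c) -F d)) (+-identityˡ (-F d)) (+-monoˡ-≤ (-F d) (inj₁ 0<2c))))
      where
      d-2c<0 : d -F (c +F c) <F 0F
      d-2c<0 = a<b+c⇒a-c<b (begin-strict
        d             ≤⟨ d≤c ⟩
        c             <⟨ a<a+c c 0<c ⟩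
        c +F c        ≡⟨ +-identityˡ (c +F c) ⟨
        0F +F (c +F c) ∎)
      |d-2c|≡2c-d : absF (d -F (c +F c)) ≡ (c +F c) -F d
      |d-2c|≡2c-d = subst (absF (d -F (c +F c)) ≡_) (⁻¹-anti-homo‿- d (c +F c)) (a<0⇒abs[a]≡-a d-2c<0)
      d≤2c-d : d ≤F ((c +F c) -F d)
      d≤2c-d = a+b≤c⇒a≤c-b (begin
        d +F d  ≤⟨ +-monoˡ-≤ d d≤c ⟩
        c +F d  ≤⟨ +-monoʳ-≤ c d≤c ⟩
        c +F c  ∎)

    to : absF (d -F (c +F c)) <F absF d → c <F d
    to lt = ≰⇒> λ d≤c → <-irrefl (begin-strict
      absF (d -F (c +F c))  <⟨ lt ⟩
      absF d                ≤⟨ abs[d]≤abs[d-2c] d≤c ⟩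
      absF (d -F (c +F c))  ∎)

  abs[a-x-[b+x]]<abs[a-b]⇔b+x<a : ∀ {a b x} → 0F <F x →
    absF ((a -F x) -F (b +F x)) <F absF (a -F b) ⇔ b +F x <F a
  abs[a-x-[b+x]]<abs[a-b]⇔b+x<a {a} {b} {x} 0<x =
    subst (λ y → absF y <F absF (a -F b) ⇔ b +F x <F a) (sym regroup)
      (⇔.trans (abs[d-2c]<abs[d]⇔c<d (a -F b) 0<x) c<a-b⇔b+c<a)
    where
    open ≡-Reasoning
    regroup : (a -F x) -F (b +F x) ≡ (a -F b) -F (x +F x)
    regroup = begin
      (a -F x) +F (-F (b +F x))          ≡⟨ cong ((a -F x) +F_) (⁻¹-∙-comm b x) ⟨
      (a +F (-F x)) +F ((-F b) +F (-F x)) ≡⟨ solve 3 (λ a b x → (a ⊕ x) ⊕ (b ⊕ x) ⊜ (a ⊕ b) ⊕ (x ⊕ x)) refl a (-F b) (-F x) ⟩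
      (a -F b) +F ((-F x) +F (-F x))      ≡⟨ cong ((a -F b) +F_) (⁻¹-∙-comm x x) ⟩
      (a -F b) -F (x +F x)               ∎

module AlgorithmProperties (F : OrderedField) {k N : ℕ} (x : Fin N → OrderedField.Carrier F)
                           (x-pos : ∀ n → OrderedField._<F_ F (OrderedField.0F F) (x n)) where
  open OrderedField F
  open OrderedFieldProperties F
  open Algorithm F {k} {N} x

  contribution : Fin K → Fin K → Fin N → Carrier
  contribution a b n = if ⌊ a Fin.≟ b ⌋ then x n else 0F

  contribution-self : ∀ a n → contribution a a n ≡ x n
  contribution-self a n with a Fin.≟ a
  ... | yes _   = refl
  ... | no a≢a = ⊥-elim (a≢a refl)

  contribution-other : ∀ {a b} n → a ≢ b → contribution a b n ≡ 0F
  contribution-other {a} {b} n a≢b with a Fin.≟ b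
  ... | yes a≡b = ⊥-elim (a≢b a≡b)
  ... | no _    = refl

  S-cong : ∀ {st st′} → (∀ n → assign st′ n ≡ assign st n) → ∀ a → S st′ a ≡ S st a
  S-cong same a = sumFin-cong +-commutativeMonoid N (λ n → cong (λ b → contribution b a n) (same n))

  candidate⇔ : ∀ {st i j n} → Candidate st i j n ⇔ (assign st n ≡ i × S st j +F x n <F S st i)
  candidate⇔ {n = n} = mk⇔ (map₂ (Equivalence.to gap⇔)) (map₂ (Equivalence.from gap⇔))
    where gap⇔ = abs[a-x-[b+x]]<abs[a-b]⇔b+x<a (x-pos n)

  LowerBound : Carrier → State K N → Set
  LowerBound L st = ∀ a → L ≤F S st a

  record Shrinks (a : Fin K) (st st′ : State K N) : Set where
    constructor shrinks
    field
      sum-≤    : S st′ a ≤F S st a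
      no-entry : ∀ n → assign st′ n ≡ a → assign st n ≡ a

  Shrinks-refl : ∀ {a} → Reflexive (Shrinks a)
  Shrinks-refl = shrinks (inj₂ refl) (λ _ n∈a → n∈a)

  Shrinks-trans : ∀ {a} → Transitive (Shrinks a)
  Shrinks-trans (shrinks S₂≤S₁ into₂) (shrinks S₃≤S₂ into₃) =
    shrinks (≤-trans S₃≤S₂ S₂≤S₁) (λ n n∈a → into₂ n (into₃ n n∈a))

  module Move {st st′ : State K N} {m : Fin N} {j : Fin K}
              (moved : ∀ n → assign st′ n ≡ (if ⌊ n Fin.≟ m ⌋ then j else assign st n)) where

    assign-moved : assign st′ m ≡ j
    assign-moved with m Fin.≟ m | moved m
    ... | yes _   | m∈j = m∈j
    ... | no m≢m | _   = ⊥-elim (m≢m refl)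

    assign-other : ∀ {n} → n ≢ m → assign st′ n ≡ assign st n
    assign-other {n} n≢m with n Fin.≟ m | moved n
    ... | yes n≡m | _   = ⊥-elim (n≢m n≡m)
    ... | no _    | eq = eq

    gains-only-receiver : ∀ {a} → j ≢ a → ∀ n → assign st′ n ≡ a → assign st n ≡ a
    gains-only-receiver j≢a n n∈a with n Fin.≟ m
    ... | yes refl = ⊥-elim (j≢a (trans (sym assign-moved) n∈a))
    ... | no n≢m   = trans (sym (assign-other n≢m)) n∈a

    S-update : ∀ a → S st′ a +F contribution (assign st m) a m ≡ S st a +F contribution j a m
    S-update a = subst (λ b → S st′ a +F contribution (assign st m) a m ≡ S st a +F contribution b a m)
      assign-moved
      (sumFin-update +-commutativeMonoid N (λ n → contribution (assign st n) a n)
        (λ n → contribution (assign st′ n) a n) m (λ n n≢m → cong (λ b → contribution b a n) (assign-other n≢m)))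

    S-donor : assign st m ≢ j → S st′ (assign st m) +F x m ≡ S st (assign st m)
    S-donor i≢j = begin
      S st′ i +F x m                ≡⟨ cong (S st′ i +F_) (contribution-self i m) ⟨
      S st′ i +F contribution i i m ≡⟨ S-update i ⟩
      S st i +F contribution j i m  ≡⟨ cong (S st i +F_) (contribution-other m (i≢j ∘ sym)) ⟩
      S st i +F 0F                  ≡⟨ +-identityʳ (S st i) ⟩
      S st i                        ∎
      where
      open ≡-Reasoning
      i = assign st m

    S-receiver : assign st m ≢ j → S st′ j ≡ S st j +F x m
    S-receiver i≢j = begin
      S st′ j                       ≡⟨ +-identityʳ (S st′ j) ⟨
      S st′ j +F 0F                 ≡⟨ cong (S st′ j +F_) (contribution-other m i≢j) ⟨
      S st′ j +F contribution i j m ≡⟨ S-update j ⟩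
      S st j +F contribution j j m  ≡⟨ cong (S st j +F_) (contribution-self j m) ⟩
      S st j +F x m                 ∎
      where
      open ≡-Reasoning
      i = assign st m

    S-other : ∀ {a} → assign st m ≢ a → j ≢ a → S st′ a ≡ S st a
    S-other {a} i≢a j≢a = begin
      S st′ a                       ≡⟨ +-identityʳ (S st′ a) ⟨
      S st′ a +F 0F                 ≡⟨ cong (S st′ a +F_) (contribution-other m i≢a) ⟨
      S st′ a +F contribution i a m ≡⟨ S-update a ⟩
      S st a +F contribution j a m  ≡⟨ cong (S st a +F_) (contribution-other m j≢a) ⟩
      S st a +F 0F                  ≡⟨ +-identityʳ (S st a) ⟩
      S st a                        ∎
      where
      open ≡-Reasoning
      i = assign st m

    module _ (gap : S st j +F x m <F S st (assign st m)) where
      open <-Reasoning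

      donor≢receiver : assign st m ≢ j
      donor≢receiver i≡j = <-irrefl (begin-strict
        S st j         <⟨ a<a+c (S st j) (x-pos m) ⟩
        S st j +F x m  <⟨ gap ⟩
        S st (assign st m) ≡⟨ cong (S st) i≡j ⟩
        S st j         ∎)

      receiver-not-max : ∀ {a} → IsMaxSet st a → j ≢ a
      receiver-not-max {a} a-max refl = <-irrefl (begin-strict
        S st a             <⟨ a<a+c (S st a) (x-pos m) ⟩
        S st a +F x m      <⟨ gap ⟩
        S st (assign st m) ≤⟨ a-max (assign st m) ⟩
        S st a             ∎)

      preserves-LowerBound : ∀ {L} → LowerBound L st → LowerBound L st′
      preserves-LowerBound {L} L≤S a with assign st m Fin.≟ a | j Fin.≟ a
      ... | yes refl | _ = inj₁ (begin-strict
        L         ≤⟨ L≤S j ⟩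
        S st j    <⟨ +-cancelʳ-< (x m) (subst (S st j +F x m <F_) (sym (S-donor donor≢receiver)) gap) ⟩
        S st′ a   ∎)
      ... | no _ | yes refl = inj₁ (begin-strict
        L              ≤⟨ L≤S j ⟩
        S st j         <⟨ a<a+c (S st j) (x-pos m) ⟩
        S st j +F x m  ≡⟨ S-receiver donor≢receiver ⟨
        S st′ j        ∎)
      ... | no i≢a | no j≢a = subst (L ≤F_) (sym (S-other i≢a j≢a)) (L≤S a)

      max-set-shrinks : ∀ {a} → IsMaxSet st a → Shrinks a st st′
      max-set-shrinks {a} a-max = shrinks S′≤S (gains-only-receiver (receiver-not-max a-max))
        where
        S′≤S : S st′ a ≤F S st a
        S′≤S with assign st m Fin.≟ a
        ... | yes refl = inj₁ (subst (S st′ a <F_) (S-donor donor≢receiver) (a<a+c (S st′ a) (x-pos m)))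
        ... | no i≢a  = inj₂ (S-other i≢a (receiver-not-max a-max))

  candidate⇒S[j]+x<S[i] : ∀ {st i j n} → Candidate st i j n → S st j +F x n <F S st i
  candidate⇒S[j]+x<S[i] {st} {i} {j} {n} cand = proj₂ (Equivalence.to (candidate⇔ {st} {i} {j} {n}) cand)

  step-preserves-LowerBound : ∀ {L st st′} → Step st st′ → LowerBound L st → LowerBound L st′
  step-preserves-LowerBound {L} {st} {st′} (discard _ _ _ _ same _) L≤S a =
    subst (L ≤F_) (sym (S-cong {st} {st′} same a)) (L≤S a)
  step-preserves-LowerBound {st = st} {st′} (move _ _ _ _ (refl , abs<) _ moved _) =
    Move.preserves-LowerBound {st} {st′} moved (candidate⇒S[j]+x<S[i] {st} (refl , abs<))

  step-shrinks-max-set : ∀ {a st st′} → Step st st′ → IsMaxSet st a → Shrinks a st st′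
  step-shrinks-max-set {st = st} {st′} (discard _ _ _ _ same _) _ =
    shrinks (inj₂ (S-cong {st} {st′} same _)) (λ n n∈a → trans (sym (same n)) n∈a)
  step-shrinks-max-set {st = st} {st′} (move _ _ _ _ (refl , abs<) _ moved _) =
    Move.max-set-shrinks {st} {st′} moved (candidate⇒S[j]+x<S[i] {st} (refl , abs<))

  record LargestCandidateMove (st : State K N) (a : Fin K) (n : Fin N) : Set where
    field
      receiver         : Fin K
      receiver-minimal : ∀ b → S st receiver ≤F S st b
      candidate        : Candidate st a receiver n
      largest          : ∀ n″ → Candidate st a receiver n″ → x n″ ≤F x n

  leaving⇒LargestCandidateMove : ∀ {st st′ a n} → Step st st′ →
    assign st n ≡ a × ¬ (assign st′ n ≡ a) → LargestCandidateMove st a n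
  leaving⇒LargestCandidateMove {n = n} (discard _ _ _ _ same _) (n∈a , n∉a) = ⊥-elim (n∉a (trans (same n) n∈a))
  leaving⇒LargestCandidateMove {st} {st′} {n = n} (move _ j m (_ , _ , _ , j-min) cand largest moved _) (n∈a , n∉a)
    with n Fin.≟ m
  ... | no n≢m = ⊥-elim (n∉a (trans (Move.assign-other {st} {st′} moved n≢m) n∈a))
  ... | yes refl with trans (sym (proj₁ cand)) n∈a
  ...   | refl = record { receiver = j ; receiver-minimal = j-min ; candidate = cand ; largest = largest }

proposition6 : (F : OrderedField) → let open OrderedField F in
    (k N : ℕ) (x : Fin N → Carrier) →
    (∀ n → 0F <F x n) →
    (∀ a b → a Fin.≤ b → x a ≤F x b) →
    let open Algorithm F {k} {N} x in
    (s : ℕ → State (suc (suc k)) N) (T : ℕ) → Execution s T →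
    (t t′ : ℕ) (n n′ : Fin N) → t < t′ → t′ < T →
    (∀ u → t ≤ u → u ≤ t′ → IsMaxSet (s u) Fin.zero) →
    LeavesFirst s t n → LeavesFirst s t′ n′ →
    x n′ ≤F x n
proposition6 F k N x x-pos _ s T (_ , step) t t′ n n′ t<t′ t′<T zero-max n-leaves n′-leaves =
  first.largest n′ (Equivalence.from (candidate⇔ {s t} {zero} {first.receiver} {n′}) (n′-in-zero-at-t , gap))
  where
  open OrderedField F
  open OrderedFieldProperties F using (module <-Reasoning; +-monoˡ-≤)
  open Algorithm F {k} {N} x
  open AlgorithmProperties F x x-pos
  open <-Reasoning

  module first  = LargestCandidateMove (leaving⇒LargestCandidateMove (step t (ℕ.<-trans t<t′ t′<T)) n-leaves)
  module second = LargestCandidateMove (leaving⇒LargestCandidateMove (step t′ t′<T) n′-leaves)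

  t≤t′ = ℕ.<⇒≤ t<t′

  L = S (s t) first.receiver

  lower-bound : LowerBound L (s t′)
  lower-bound = compose-steps {R = λ st st′ → LowerBound L st → LowerBound L st′}
    (λ L≤S → L≤S) (λ f g → g ∘ f) s t≤t′
    (λ _ u<t′ → step-preserves-LowerBound (step _ (ℕ.<-trans u<t′ t′<T))) first.receiver-minimal

  zero-shrinks : Shrinks zero (s t) (s t′)
  zero-shrinks = compose-steps {R = Shrinks zero} Shrinks-refl Shrinks-trans s t≤t′
    (λ t≤u u<t′ → step-shrinks-max-set (step _ (ℕ.<-trans u<t′ t′<T)) (zero-max _ t≤u (ℕ.<⇒≤ u<t′)))

  n′-in-zero-at-t : assign (s t) n′ ≡ zero
  n′-in-zero-at-t = Shrinks.no-entry zero-shrinks n′ (proj₁ n′-leaves)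

  gap : L +F x n′ <F S (s t) zero
  gap = begin-strict
    L +F x n′                         ≤⟨ +-monoˡ-≤ (x n′) (lower-bound second.receiver) ⟩
    S (s t′) second.receiver +F x n′  <⟨ candidate⇒S[j]+x<S[i] {s t′} second.candidate ⟩
    S (s t′) zero                     ≤⟨ Shrinks.sum-≤ zero-shrinks ⟩
    S (s t) zero                      ∎
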